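{- Let $Q=\{q_1<\cdots<q_k\}$ and $W=\{w_1<\cdots<w_k\}$ be disjoint subsets of $\mathbb Z_{\ge 2}$ with $k\ge1$ elements each. If $(Q,W)$ is admissible, then for every integer $i$ with $0\le i\le k-1$, the pair $(Q\setminus\{q_k,q_{k-1},\dots,q_{k-i}\},\ W\setminus\{w_k,w_{k-1},\dots,w_{k-i}\})$ is also admissible.
   Context: A circular $n$-permutation is a permutation $\sigma=(\sigma(1),\dots,\sigma(n))$ of $[n]=\{1,\dots,n\}$ with the cyclic conventions $\sigma(0)=\sigma(n)$, $\sigma(n+1)=\sigma(1)$, considered modulo cyclic rotation; the set of these is $\overline{\mathfrak S}_n$. $\sigma(i)$ is a pinnacle if $\sigma(i-1)<\sigma(i)>\sigma(i+1)$ and a vale if $\sigma(i-1)>\sigma(i)<\sigma(i+1)$; $P(\sigma)$, $V(\sigma)$ are the sets of pinnacles and vales. For subsets $Q,W\subset\mathbb Z_{\ge2}$, the pair $(Q,W)$ is $n$-admissible if $n>\max Q$ (no condition if $Q=\emptyset$) and there exists $\sigma\in\overline{\mathfrak S}_n$ with $P(\sigma)=Q\cup\{n\}$ and $V(\sigma)=W\cup\{1\}$; it is admissible if it is $n$-admissible for some $n$. -}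

module Defs where

open import Data.Nat using (ℕ; zero; suc; _+_; _∸_; _<_; _≤_)
open import Data.Nat.DivMod using (_%_)
open import Data.List using (List; []; _∷_; length; map; upTo)
open import Data.List.Membership.Propositional using (_∈_)
open import Data.List.Relation.Binary.Permutation.Propositional using (_↭_)
open import Data.Product using (Σ; ∃-syntax; _×_)
open import Data.Sum using (_⊎_)
open import Function.Bundles using (_⇔_)
open import Relation.Binary.PropositionalEquality using (_≡_)

oneTo : ℕ → List ℕ
oneTo n = map suc (upTo n)

-- i-th entry of a list (0-based), default 0 out of range
nth : List ℕ → ℕ → ℕ
nth []       _       = 0
nth (x ∷ xs) zero    = x
nth (x ∷ xs) (suc i) = nth xs i

cyc : List ℕ → ℕ → ℕ
cyc σ j with length σ
... | zero  = 0
... | suc m = nth σ (j % suc m)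

-- A circular n-permutation is represented by one of its linear
-- representatives σ = (σ(1),...,σ(n)) (a list that is a permutation of [1..n]),
-- with cyclic conventions σ(0)=σ(n), σ(n+1)=σ(1).
-- Position i (0-based) has cyclic predecessor i+n-1 mod n and successor i+1 mod n.
IsPinnacle : List ℕ → ℕ → Set
IsPinnacle σ x = ∃[ i ] (i < length σ × nth σ i ≡ x
                    × cyc σ (i + length σ ∸ 1) < x × cyc σ (suc i) < x)

IsVale : List ℕ → ℕ → Set
IsVale σ x = ∃[ i ] (i < length σ × nth σ i ≡ x
                    × x < cyc σ (i + length σ ∸ 1) × x < cyc σ (suc i))

NAdmissible : ℕ → List ℕ → List ℕ → Set
NAdmissible n Q W =
  (∀ q → q ∈ Q → q < n) ×
  ∃[ σ ] (σ ↭ oneTo n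
         × (∀ x → IsPinnacle σ x ⇔ (x ∈ Q ⊎ x ≡ n))
         × (∀ x → IsVale σ x ⇔ (x ∈ W ⊎ x ≡ 1)))

Admissible : List ℕ → List ℕ → Set
Admissible Q W = ∃[ n ] NAdmissible n Q W

module Submission where

-- For |Q| = |W|, the pair (Q, W) is admissible exactly when it is interlaced, w_j < q_j for
-- every j, and interlacing passes to prefixes.
--
-- Necessity: fix a level t with 1 ≤ t < n. For a window (a, b, c) of the cycle with b ≤ t,
-- [b < c] + [b is a pinnacle] ≤ [a < b] + [b is a vale]. Summed around the cycle, the first terms
-- count the ascents leaving a value ≤ t and the third ones the ascents arriving at a value ≤ t.
-- Every ascent of the second kind is of the first kind, and an edge crossing the level is of the
-- first kind only, so more vales than pinnacles are ≤ t. At t = q_j at least j pinnacles are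
-- ≤ t, hence (the vale 1 not being in W) at least j elements of W, i.e. w_j < q_j.
--
-- Sufficiency: with N > max (Q ∪ W), the cyclic permutation
--   N, (the unused values of [2, N) in decreasing order), 1, q_1, w_1, ..., q_k, w_k
-- has pinnacles Q ∪ {N} and vales W ∪ {1}.

open import Defs
open import Algebra.Properties.CommutativeSemigroup using (interchange)
open import Data.Bool using (true; false; if_then_else_)
open import Data.Bool.Properties using (∧-zeroʳ)
open import Data.List using (List; []; _∷_; [_]; _++_; length; map; filter; take; downFrom)
open import Data.List.Extrema.Nat using (max; xs≤max; v≤max⁺)
open import Data.List.Membership.Propositional using (_∈_; _∉_)
open import Data.List.Membership.Propositional.Properties
  using ( ∈-map⁺; ∈-map⁻; ∈-filter⁺; ∈-filter⁻; ∈-++⁺ˡ; ∈-++⁺ʳ; ∈-++⁻; ∈-∃++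
        ; ∈-upTo⁺; ∈-upTo⁻; ∈-downFrom⁺; ∈-downFrom⁻)
open import Data.List.Membership.Propositional.Properties.WithK using (unique∧set⇒bag)
open import Data.List.Properties using (filter-accept; filter-reject; filter-none; ++-assoc; length-++)
open import Data.List.Relation.Binary.BagAndSetEquality using (∼bag⇒↭)
open import Data.List.Relation.Binary.Permutation.Propositional using (_↭_; ↭-refl; ↭-sym; ↭-trans; prep; ↭⇒↭ₛ)
open import Data.List.Relation.Binary.Permutation.Propositional.Properties
  using (↭-length; filter-↭; shift; ++-comm; ++⁺ˡ; All-resp-↭; ∈-resp-↭)
open import Data.List.Relation.Binary.Pointwise using (Pointwise; []; _∷_)
open import Data.List.Relation.Binary.Subset.Propositional using (_⊆_)
open import Data.List.Relation.Unary.All as All using (All; []; _∷_)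
import Data.List.Relation.Unary.All.Properties as All
open import Data.List.Relation.Unary.AllPairs as AllPairs using (AllPairs; []; _∷_)
import Data.List.Relation.Unary.AllPairs.Properties as AllPairs
open import Data.List.Relation.Unary.Any as Any using (Any; here; there)
import Data.List.Relation.Unary.Any.Properties as Any
open import Data.List.Relation.Unary.Unique.Propositional using (Unique)
import Data.List.Relation.Unary.Unique.Propositional.Properties as Unique
open import Data.Nat using (ℕ; zero; suc; _+_; _∸_; _<_; _≤_; _>_; z≤n; s≤s; _≤?_; _<?_; _≤ᵇ_; _<ᵇ_)
open import Data.Nat.DivMod using (m<n⇒m%n≡m; [m+n]%n≡m%n; n%n≡0)
open import Data.Nat.Properties
open import Data.Product using (_×_; _,_; proj₁; proj₂; ∃-syntax; uncurry)
open import Data.Sum using (_⊎_; inj₁; inj₂; [_,_]′)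
open import Function using (_∘_)
open import Function.Bundles using (_⇔_; mk⇔; Equivalence)
open import Function.Construct.Composition using (_⇔-∘_)
open import Level using (0ℓ)
open import Relation.Binary.PropositionalEquality
  using (module ≡-Reasoning; _≡_; _≢_; refl; sym; trans; cong; cong₂; subst; subst₂; ≢-sym; setoid)
open import Relation.Nullary using (Dec; yes; no; does; ¬_; ¬?; contradiction; _×-dec_)
open import Relation.Nullary.Reflects using (ofʸ; ofⁿ)
open import Relation.Unary using (Pred; Decidable)
open import Relation.Unary.Properties using (_∩?_)
open import Data.List.Membership.DecPropositional _≟_ using (_∈?_)
open import Data.List.Relation.Binary.Permutation.Setoid.Properties (setoid ℕ) using (Unique-resp-↭)

nth-++ˡ : ∀ xs ys {i} → i < length xs → nth (xs ++ ys) i ≡ nth xs i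
nth-++ˡ (x ∷ xs) ys {zero}  _           = refl
nth-++ˡ (x ∷ xs) ys {suc i} (s≤s i<len) = nth-++ˡ xs ys i<len

nth-length-∷ʳ : ∀ xs z → nth (xs ++ [ z ]) (length xs) ≡ z
nth-length-∷ʳ []       z = refl
nth-length-∷ʳ (x ∷ xs) z = nth-length-∷ʳ xs z

lastOf : ℕ → List ℕ → ℕ
lastOf x []       = x
lastOf _ (y ∷ ys) = lastOf y ys

lastOf-nth : ∀ y ys → lastOf y ys ≡ nth (y ∷ ys) (length ys)
lastOf-nth y []       = refl
lastOf-nth y (z ∷ zs) = lastOf-nth z zs

lastOf-∈ : ∀ x xs → lastOf x xs ∈ x ∷ xs
lastOf-∈ x []       = here refl
lastOf-∈ x (y ∷ ys) = there (lastOf-∈ y ys)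

lastOf-++ : ∀ x xs y ys → lastOf x (xs ++ y ∷ ys) ≡ lastOf y ys
lastOf-++ x []       y ys = refl
lastOf-++ x (z ∷ zs) y ys = lastOf-++ z zs y ys

∈-∷⇔ : ∀ {x y : ℕ} {ys} → x ∈ y ∷ ys ⇔ (x ∈ ys ⊎ x ≡ y)
∈-∷⇔ = mk⇔ (λ { (here x≡y) → inj₂ x≡y ; (there x∈ys) → inj₁ x∈ys }) [ there , here ]′

∈-take : ∀ n {xs : List ℕ} {x} → x ∈ take n xs → x ∈ xs
∈-take (suc n) {_ ∷ _} (here refl) = here refl
∈-take (suc n) {_ ∷ _} (there x∈)  = there (∈-take n x∈)

Pointwise-take : ∀ {R : ℕ → ℕ → Set} n {xs ys} → Pointwise R xs ys → Pointwise R (take n xs) (take n ys)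
Pointwise-take zero    _        = []
Pointwise-take (suc n) []       = []
Pointwise-take (suc n) (r ∷ rs) = r ∷ Pointwise-take n rs

sorted⇒unique : ∀ {xs} → AllPairs _<_ xs → Unique xs
sorted⇒unique = AllPairs.map <⇒≢

unique-resp-↭ : ∀ {xs ys : List ℕ} → xs ↭ ys → Unique ys → Unique xs
unique-resp-↭ xs↭ys = Unique-resp-↭ (↭⇒↭ₛ (↭-sym xs↭ys))

length-mono-⊆ : ∀ {A : Set} {xs ys : List A} → Unique xs → xs ⊆ ys → length xs ≤ length ys
length-mono-⊆ {xs = []}     _            _     = z≤n
length-mono-⊆ {xs = x ∷ xs} (x∉xs ∷ !xs) xs⊆ys with zs₁ , zs₂ , refl ← ∈-∃++ (xs⊆ys (here refl)) =
  ≤-trans (s≤s (length-mono-⊆ !xs xs⊆zs)) (≤-reflexive (sym (↭-length (shift x zs₁ zs₂))))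
  where
  xs⊆zs : xs ⊆ zs₁ ++ zs₂
  xs⊆zs z∈xs with ∈-++⁻ zs₁ (xs⊆ys (there z∈xs))
  ... | inj₁ z∈zs₁         = ∈-++⁺ˡ z∈zs₁
  ... | inj₂ (here refl)   = contradiction refl (All.lookup x∉xs z∈xs)
  ... | inj₂ (there z∈zs₂) = ∈-++⁺ʳ zs₁ z∈zs₂

∈-oneTo⁺ : ∀ {n x} → 1 ≤ x → x ≤ n → x ∈ oneTo n
∈-oneTo⁺ {x = suc i} _ i<n = ∈-map⁺ suc (∈-upTo⁺ i<n)

∈-oneTo⁻ : ∀ {n x} → x ∈ oneTo n → 1 ≤ x × x ≤ n
∈-oneTo⁻ x∈ with _ , i∈ , refl ← ∈-map⁻ suc x∈ = s≤s z≤n , ∈-upTo⁻ i∈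

oneTo-unique : ∀ n → Unique (oneTo n)
oneTo-unique n = Unique.map⁺ suc-injective (Unique.upTo⁺ n)

𝟙 : ∀ {P : Set} → Dec P → ℕ
𝟙 P? = if does P? then 1 else 0

count : ∀ {A : Set} {P : Pred A 0ℓ} → Decidable P → List A → ℕ
count P? xs = length (filter P? xs)

module _ {A : Set} where

  count-∷ : ∀ {P : Pred A 0ℓ} (P? : Decidable P) x xs → count P? (x ∷ xs) ≡ 𝟙 (P? x) + count P? xs
  count-∷ P? x xs with does (P? x)
  ... | true  = refl
  ... | false = refl

  count-accept : ∀ {P : Pred A 0ℓ} (P? : Decidable P) {x} xs → P x → count P? (x ∷ xs) ≡ suc (count P? xs)
  count-accept P? xs Px = cong length (filter-accept P? Px)

  count-map : ∀ {B : Set} {P : Pred B 0ℓ} (P? : Decidable P) (f : A → B) xs →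
    count P? (map f xs) ≡ count (P? ∘ f) xs
  count-map P? f []       = refl
  count-map P? f (x ∷ xs) with does (P? (f x))
  ... | true  = cong suc (count-map P? f xs)
  ... | false = count-map P? f xs

  count-filter : ∀ {P Q : Pred A 0ℓ} (P? : Decidable P) (Q? : Decidable Q) xs →
    count P? (filter Q? xs) ≡ count (P? ∩? Q?) xs
  count-filter P? Q? []       = refl
  count-filter P? Q? (x ∷ xs) with does (Q? x)
  ... | false rewrite ∧-zeroʳ (does (P? x)) = count-filter P? Q? xs
  ... | true with does (P? x)
  ...   | true  = cong suc (count-filter P? Q? xs)
  ...   | false = count-filter P? Q? xs

  count-↭ : ∀ {P : Pred A 0ℓ} (P? : Decidable P) {xs ys} → xs ↭ ys → count P? xs ≡ count P? ys
  count-↭ P? xs↭ys = ↭-length (filter-↭ P? xs↭ys)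

  module _ {P Q : Pred A 0ℓ} (P? : Decidable P) (Q? : Decidable Q) (P⇒Q : ∀ {x} → P x → Q x) where

    count-mono : ∀ xs → count P? xs ≤ count Q? xs
    count-mono []       = z≤n
    count-mono (x ∷ xs) with P? x | Q? x
    ... | yes _  | yes _  = s≤s (count-mono xs)
    ... | yes Px | no ¬Qx = contradiction (P⇒Q Px) ¬Qx
    ... | no _   | yes _  = m≤n⇒m≤1+n (count-mono xs)
    ... | no _   | no _   = count-mono xs

    count-mono-< : ∀ {xs} → Any (λ x → ¬ P x × Q x) xs → count P? xs < count Q? xs
    count-mono-< {x ∷ xs} (here (¬Px , Qx)) with P? x | Q? x
    ... | yes Px | _      = contradiction Px ¬Px
    ... | no _   | no ¬Qx = contradiction Qx ¬Qx
    ... | no _   | yes _  = s≤s (count-mono xs)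
    count-mono-< {x ∷ xs} (there any) with P? x | Q? x
    ... | yes _  | yes _  = s≤s (count-mono-< any)
    ... | yes Px | no ¬Qx = contradiction (P⇒Q Px) ¬Qx
    ... | no _   | yes _  = m<n⇒m<1+n (count-mono-< any)
    ... | no _   | no _   = count-mono-< any

  count-+-mono : ∀ {P Q R S : Pred A 0ℓ}
    (P? : Decidable P) (Q? : Decidable Q) (R? : Decidable R) (S? : Decidable S) {xs} →
    All (λ x → 𝟙 (P? x) + 𝟙 (Q? x) ≤ 𝟙 (R? x) + 𝟙 (S? x)) xs →
    count P? xs + count Q? xs ≤ count R? xs + count S? xs
  count-+-mono P? Q? R? S? []                  = z≤n
  count-+-mono P? Q? R? S? {x ∷ xs} (le ∷ les) = begin
    count P? (x ∷ xs) + count Q? (x ∷ xs)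
      ≡⟨ cong₂ _+_ (count-∷ P? x xs) (count-∷ Q? x xs) ⟩
    (𝟙 (P? x) + count P? xs) + (𝟙 (Q? x) + count Q? xs)
      ≡⟨ interchange +-commutativeSemigroup (𝟙 (P? x)) (count P? xs) (𝟙 (Q? x)) (count Q? xs) ⟩
    (𝟙 (P? x) + 𝟙 (Q? x)) + (count P? xs + count Q? xs)
      ≤⟨ +-mono-≤ le (count-+-mono P? Q? R? S? les) ⟩
    (𝟙 (R? x) + 𝟙 (S? x)) + (count R? xs + count S? xs)
      ≡⟨ interchange +-commutativeSemigroup (𝟙 (R? x)) (𝟙 (S? x)) (count R? xs) (count S? xs) ⟩
    (𝟙 (R? x) + count R? xs) + (𝟙 (S? x) + count S? xs)
      ≡⟨ cong₂ _+_ (count-∷ R? x xs) (count-∷ S? x xs) ⟨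
    count R? (x ∷ xs) + count S? (x ∷ xs)
      ∎
    where open ≤-Reasoning

-- Windows and edges of a cyclic permutation

Window : Set
Window = ℕ × ℕ × ℕ

middle : Window → ℕ
middle (_ , b , _) = b

windows : List ℕ → List Window
windows (a ∷ b ∷ c ∷ r) = (a , b , c) ∷ windows (b ∷ c ∷ r)
windows _               = []

window : List ℕ → ℕ → Window
window u i = nth u i , nth u (1 + i) , nth u (2 + i)

∈-windows⁺ : ∀ u i → 2 + i < length u → window u i ∈ windows u
∈-windows⁺ (a ∷ b ∷ c ∷ r) zero    _             = here refl
∈-windows⁺ (a ∷ b ∷ c ∷ r) (suc i) (s≤s 3+i<len) = there (∈-windows⁺ (b ∷ c ∷ r) i 3+i<len)
∈-windows⁺ (a ∷ b ∷ [])    i       (s≤s (s≤s ()))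
∈-windows⁺ (a ∷ [])        i       (s≤s ())

∈-windows⁻ : ∀ u {w} → w ∈ windows u → ∃[ i ] (2 + i < length u × w ≡ window u i)
∈-windows⁻ (a ∷ b ∷ c ∷ r) (here refl) = 0 , s≤s (s≤s (s≤s z≤n)) , refl
∈-windows⁻ (a ∷ b ∷ c ∷ r) (there w∈) with i , lt , refl ← ∈-windows⁻ (b ∷ c ∷ r) w∈ = suc i , s≤s lt , refl

middles-windows : ∀ a v z → map middle (windows (a ∷ v ++ [ z ])) ≡ v
middles-windows a []          z = refl
middles-windows a (b ∷ [])    z = refl
middles-windows a (b ∷ c ∷ v) z = cong (b ∷_) (middles-windows b (c ∷ v) z)

-- σ(n), σ(1), ..., σ(n), σ(1): its windows are the cyclic windows of σ.
closeUp : List ℕ → List ℕ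
closeUp []       = []
closeUp (y ∷ ys) = lastOf y ys ∷ (y ∷ ys) ++ [ y ]

cyclicWindow : List ℕ → ℕ → Window
cyclicWindow σ i = cyc σ (i + length σ ∸ 1) , nth σ i , cyc σ (suc i)

module _ (y : ℕ) (ys : List ℕ) where
  private
    σ = y ∷ ys
    n = length σ

  nth-closeUp-pred : ∀ i → i < n → nth (closeUp σ) i ≡ cyc σ (i + n ∸ 1)
  nth-closeUp-pred zero    _     = trans (lastOf-nth y ys) (cong (nth σ) (sym (m<n⇒m%n≡m (n<1+n (length ys)))))
  nth-closeUp-pred (suc i) i+1<n = trans (nth-++ˡ σ [ y ] i<n)
    (cong (nth σ) (sym (trans ([m+n]%n≡m%n i n) (m<n⇒m%n≡m i<n))))
    where i<n = <-trans (n<1+n i) i+1<n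

  nth-closeUp : ∀ i → i < n → nth (closeUp σ) (1 + i) ≡ nth σ i
  nth-closeUp i i<n = nth-++ˡ σ [ y ] i<n

  nth-closeUp-succ : ∀ i → i < n → nth (closeUp σ) (2 + i) ≡ cyc σ (suc i)
  nth-closeUp-succ i i<n with m≤n⇒m<n∨m≡n i<n
  ... | inj₁ i+1<n = trans (nth-++ˡ σ [ y ] i+1<n) (cong (nth σ) (sym (m<n⇒m%n≡m i+1<n)))
  ... | inj₂ refl  = trans (nth-length-∷ʳ σ y) (cong (nth σ) (sym (n%n≡0 n)))

  window-closeUp : ∀ i → i < n → window (closeUp σ) i ≡ cyclicWindow σ i
  window-closeUp i i<n
    rewrite nth-closeUp-pred i i<n | nth-closeUp i i<n | nth-closeUp-succ i i<n = refl

  length-closeUp : length (closeUp σ) ≡ 2 + n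
  length-closeUp = cong suc (trans (length-++ σ) (+-comm n 1))

∈-cyclicWindows⁺ : ∀ σ i → i < length σ → cyclicWindow σ i ∈ windows (closeUp σ)
∈-cyclicWindows⁺ (y ∷ ys) i i<n = subst (_∈ windows (closeUp (y ∷ ys))) (window-closeUp y ys i i<n)
  (∈-windows⁺ (closeUp (y ∷ ys)) i (subst (2 + i <_) (sym (length-closeUp y ys)) (s≤s (s≤s i<n))))

∈-cyclicWindows⁻ : ∀ σ {w} → w ∈ windows (closeUp σ) → ∃[ i ] (i < length σ × w ≡ cyclicWindow σ i)
∈-cyclicWindows⁻ (y ∷ ys) w∈ with i , lt , refl ← ∈-windows⁻ (closeUp (y ∷ ys)) w∈ =
  i , i<n , window-closeUp y ys i i<n
  where
  i<n : i < length (y ∷ ys)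
  i<n = ≤-pred (≤-pred (subst (2 + i <_) (length-closeUp y ys) lt))

Peak Pit : Pred Window 0ℓ
Peak (a , b , c) = a < b × c < b
Pit  (a , b , c) = b < a × b < c

peak? : Decidable Peak
peak? (a , b , c) = a <? b ×-dec c <? b

pit? : Decidable Pit
pit? (a , b , c) = b <? a ×-dec b <? c

extrema : {P : Pred Window 0ℓ} → Decidable P → List ℕ → List ℕ
extrema P? u = map middle (filter P? (windows u))

pinnacles vales : List ℕ → List ℕ
pinnacles σ = extrema peak? (closeUp σ)
vales     σ = extrema pit? (closeUp σ)

module _ {P : Pred Window 0ℓ} (P? : Decidable P) where

  IsCyclicExtremum : List ℕ → ℕ → Set
  IsCyclicExtremum σ x =
    ∃[ i ] (i < length σ × nth σ i ≡ x × P (cyc σ (i + length σ ∸ 1) , x , cyc σ (suc i)))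

  isCyclicExtremum⇔∈extrema : ∀ σ x → IsCyclicExtremum σ x ⇔ x ∈ extrema P? (closeUp σ)
  isCyclicExtremum⇔∈extrema σ x = mk⇔ to from
    where
    to : IsCyclicExtremum σ x → x ∈ extrema P? (closeUp σ)
    to (i , i<n , refl , Pw) = ∈-map⁺ middle (∈-filter⁺ P? (∈-cyclicWindows⁺ σ i i<n) Pw)
    from : x ∈ extrema P? (closeUp σ) → IsCyclicExtremum σ x
    from x∈ with ∈-map⁻ middle x∈
    ... | w , w∈ , refl with ∈-filter⁻ P? w∈
    ... | w∈ws , Pw with ∈-cyclicWindows⁻ σ w∈ws
    ... | i , i<n , refl = i , i<n , refl , Pw

  extrema-unique : ∀ σ → Unique σ → Unique (extrema P? (closeUp σ))
  extrema-unique []       _  = []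
  extrema-unique (y ∷ ys) !σ = AllPairs.map⁺ (AllPairs.filter⁺ P?
    (AllPairs.map⁻ (subst Unique (sym (middles-windows (lastOf y ys) (y ∷ ys) y)) !σ)))

  extrema-accept : ∀ {a b c} r → P (a , b , c) → extrema P? (a ∷ b ∷ c ∷ r) ≡ b ∷ extrema P? (b ∷ c ∷ r)
  extrema-accept r Pw = cong (map middle) (filter-accept P? Pw)

  extrema-reject : ∀ {a b c} r → ¬ P (a , b , c) → extrema P? (a ∷ b ∷ c ∷ r) ≡ extrema P? (b ∷ c ∷ r)
  extrema-reject r ¬Pw = cong (map middle) (filter-reject P? ¬Pw)

  extrema-reject-all : ∀ {a b} r → (∀ {c} → ¬ P (a , b , c)) → extrema P? (a ∷ b ∷ r) ≡ extrema P? (b ∷ r)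
  extrema-reject-all []      _   = refl
  extrema-reject-all (c ∷ r) ¬Pw = extrema-reject r ¬Pw

  extrema-descent : (∀ {a b c} → b < a → c < b → ¬ P (a , b , c)) →
    ∀ x R {z} v → AllPairs _>_ (x ∷ R) → All (z <_) R →
    extrema P? (x ∷ R ++ z ∷ v) ≡ extrema P? (lastOf x R ∷ z ∷ v)
  extrema-descent ¬P x []           v _                                   _         = refl
  extrema-descent ¬P x (r ∷ [])     v ((r<x ∷ _) ∷ _)                     (z<r ∷ _) = extrema-reject v (¬P r<x z<r)
  extrema-descent ¬P x (r ∷ r′ ∷ R) v ((r<x ∷ _) ∷ R↓@((r′<r ∷ _) ∷ _)) (_ ∷ z<R) =
    trans (extrema-reject (R ++ _ ∷ v) (¬P r<x r′<r)) (extrema-descent ¬P r (r′ ∷ R) v R↓ z<R)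

isPinnacle⇔∈pinnacles : ∀ σ x → IsPinnacle σ x ⇔ x ∈ pinnacles σ
isPinnacle⇔∈pinnacles = isCyclicExtremum⇔∈extrema peak?

isVale⇔∈vales : ∀ σ x → IsVale σ x ⇔ x ∈ vales σ
isVale⇔∈vales = isCyclicExtremum⇔∈extrema pit?

peak-descent : ∀ {ℓ x z} R v → ℓ < x → z < x → AllPairs _>_ (x ∷ R) → All (z <_) R →
  extrema peak? (ℓ ∷ x ∷ R ++ z ∷ v) ≡ x ∷ extrema peak? (lastOf x R ∷ z ∷ v)
peak-descent []      v ℓ<x z<x _                  _   = extrema-accept peak? v (ℓ<x , z<x)
peak-descent (r ∷ R) v ℓ<x _   x↓@((r<x ∷ _) ∷ _) z<R = trans (extrema-accept peak? (R ++ _ ∷ v) (ℓ<x , r<x))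
  (cong (_ ∷_) (extrema-descent peak? (λ b<a _ (a<b , _) → <-asym a<b b<a) _ (r ∷ R) v x↓ z<R))

pit-descent : ∀ {ℓ x z} R v → ℓ < x → AllPairs _>_ (x ∷ R) → All (z <_) R →
  extrema pit? (ℓ ∷ x ∷ R ++ z ∷ v) ≡ extrema pit? (lastOf x R ∷ z ∷ v)
pit-descent R v ℓ<x x↓ z<R = trans (extrema-reject-all pit? (R ++ _ ∷ v) (λ (x<ℓ , _) → <-asym ℓ<x x<ℓ))
  (extrema-descent pit? (λ _ c<b (_ , b<c) → <-asym b<c c<b) _ R v x↓ z<R)

Edge : Set
Edge = ℕ × ℕ

leftEdge rightEdge : Window → Edge
leftEdge  (a , b , _) = a , b
rightEdge (_ , b , c) = b , c

edges : List ℕ → List Edge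
edges (a ∷ b ∷ r) = (a , b) ∷ edges (b ∷ r)
edges _           = []

edges-∷⁺ : ∀ {P : Pred Edge 0ℓ} x {xs} → Any P (edges xs) → Any P (edges (x ∷ xs))
edges-∷⁺ x {y ∷ ys} any = there any

edges-∷ʳ : ∀ x xs z → edges ((x ∷ xs) ++ [ z ]) ≡ edges (x ∷ xs) ++ [ (lastOf x xs , z) ]
edges-∷ʳ x []       z = refl
edges-∷ʳ x (y ∷ ys) z = cong ((x , y) ∷_) (edges-∷ʳ y ys z)

edges⁺ : ∀ {R : ℕ → ℕ → Set} {xs} → AllPairs R xs → All (uncurry R) (edges xs)
edges⁺ {xs = []}         _                = []
edges⁺ {xs = x ∷ []}     _                = []
edges⁺ {xs = x ∷ y ∷ xs} ((Rxy ∷ _) ∷ Rs) = Rxy ∷ edges⁺ Rs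

leftEdges-windows : ∀ a v z → map leftEdge (windows (a ∷ v ++ [ z ])) ≡ edges (a ∷ v)
leftEdges-windows a []          z = refl
leftEdges-windows a (b ∷ [])    z = refl
leftEdges-windows a (b ∷ c ∷ v) z = cong ((a , b) ∷_) (leftEdges-windows b (c ∷ v) z)

rightEdges-windows : ∀ a v z → map rightEdge (windows (a ∷ v ++ [ z ])) ≡ edges (v ++ [ z ])
rightEdges-windows a []          z = refl
rightEdges-windows a (b ∷ [])    z = refl
rightEdges-windows a (b ∷ c ∷ v) z = cong ((b , c) ∷_) (rightEdges-windows b (c ∷ v) z)

-- Both lists enumerate the edges of the cycle, the second one starting one step later.
leftEdges↭rightEdges : ∀ σ → map leftEdge (windows (closeUp σ)) ↭ map rightEdge (windows (closeUp σ))
leftEdges↭rightEdges []       = ↭-refl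
leftEdges↭rightEdges (y ∷ ys) = subst₂ _↭_
  (sym (leftEdges-windows ℓ (y ∷ ys) y))
  (sym (trans (rightEdges-windows ℓ (y ∷ ys) y) (edges-∷ʳ y ys y)))
  (++-comm [ (ℓ , y) ] (edges (y ∷ ys)))
  where ℓ = lastOf y ys

cyclicEdges-distinct : ∀ y w r → Unique (y ∷ w ∷ r) →
  All (uncurry _≢_) (map rightEdge (windows (closeUp (y ∷ w ∷ r))))
cyclicEdges-distinct y w r !σ@(y∉ ∷ _) =
  subst (All (uncurry _≢_)) (sym (trans (rightEdges-windows (lastOf w r) (y ∷ w ∷ r) y) (edges-∷ʳ y (w ∷ r) y)))
    (All.++⁺ (edges⁺ !σ) (≢-sym (All.lookup y∉ (lastOf-∈ w r)) ∷ []))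

-- Counting below a level

module _ (t : ℕ) where

  Crossing AscentInto AscentFrom : Pred Edge 0ℓ
  Crossing   (u , v) = u ≤ t × t < v
  AscentInto (u , v) = v ≤ t × u < v
  AscentFrom (u , v) = u ≤ t × u < v

  ascentInto? : Decidable AscentInto
  ascentInto? (u , v) = v ≤? t ×-dec u <? v

  ascentFrom? : Decidable AscentFrom
  ascentFrom? (u , v) = u ≤? t ×-dec u <? v

  low? : Decidable (λ w → middle w ≤ t)
  low? w = middle w ≤? t

  crossing-from : ∀ {x} xs → x ≤ t → Any (t <_) xs → Any Crossing (edges (x ∷ xs))
  crossing-from (y ∷ ys) x≤t any with t <? y | any
  ... | yes t<y | _          = here (x≤t , t<y)
  ... | no t≮y  | here t<y   = contradiction t<y t≮y
  ... | no t≮y  | there any′ = there (crossing-from ys (≮⇒≥ t≮y) any′)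

  crossing-before : ∀ xs {z} → Any (_≤ t) xs → t < z → Any Crossing (edges (xs ++ [ z ]))
  crossing-before (x ∷ xs) any t<z with x ≤? t | any
  ... | yes x≤t | _          = crossing-from (xs ++ [ _ ]) x≤t (Any.++⁺ʳ xs (here t<z))
  ... | no x≰t  | here x≤t   = contradiction x≤t x≰t
  ... | no _    | there any′ = edges-∷⁺ x (crossing-before xs any′ t<z)

  cyclic-crossing : ∀ σ → Any (_≤ t) σ → Any (t <_) σ → Any Crossing (map rightEdge (windows (closeUp σ)))
  cyclic-crossing (y ∷ ys) low high =
    subst (Any Crossing) (sym (rightEdges-windows (lastOf y ys) (y ∷ ys) y)) (crossing high)
    where
    crossing : Any (t <_) (y ∷ ys) → Any Crossing (edges ((y ∷ ys) ++ [ y ]))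
    crossing high with t <? y | high
    ... | yes t<y | _           = crossing-before (y ∷ ys) low t<y
    ... | no t≮y  | here t<y    = contradiction t<y t≮y
    ... | no t≮y  | there high′ = crossing-from (ys ++ [ y ]) (≮⇒≥ t≮y) (Any.++⁺ˡ high′)

  crossing⇒ascentFrom : ∀ w → Crossing (rightEdge w) → ¬ AscentInto (rightEdge w) × AscentFrom (rightEdge w)
  crossing⇒ascentFrom (a , b , c) (b≤t , t<c) = (λ (c≤t , _) → <⇒≱ t<c c≤t) , b≤t , ≤-<-trans b≤t t<c

  ascentInto⇒ascentFrom : ∀ {e} → AscentInto e → AscentFrom e
  ascentInto⇒ascentFrom (v≤t , u<v) = ≤-trans (<⇒≤ u<v) v≤t , u<v

  -- For a centre b ≤ t this reads [b < c] + [peak] ≤ [a < b] + [pit]. The decisions compute to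
  -- the Boolean tests _≤ᵇ_ and _<ᵇ_, which is what the case split is on.
  window-balance : ∀ w → uncurry _≢_ (leftEdge w) →
    𝟙 (ascentFrom? (rightEdge w)) + 𝟙 ((low? ∩? peak?) w)
      ≤ 𝟙 (ascentInto? (leftEdge w)) + 𝟙 ((low? ∩? pit?) w)
  window-balance (a , b , c) a≢b with b ≤ᵇ t
  ... | false = z≤n
  ... | true with a <ᵇ b | <ᵇ-reflects-< a b
  ...   | true | _ with b <ᵇ c | <ᵇ-reflects-< b c | c <ᵇ b | <ᵇ-reflects-< c b
  ...     | true  | ofʸ b<c | true  | ofʸ c<b = contradiction c<b (<-asym b<c)
  ...     | true  | _       | false | _       = s≤s z≤n
  ...     | false | _       | true  | _       = s≤s z≤n
  ...     | false | _       | false | _       = z≤n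
  window-balance (a , b , c) a≢b | true | false | ofⁿ a≮b with b <ᵇ c
  ...     | false = z≤n
  ...     | true with b <ᵇ a | <ᵇ-reflects-< b a
  ...       | true  | _       = s≤s z≤n
  ...       | false | ofⁿ b≮a = contradiction (≤-antisym (≮⇒≥ b≮a) (≮⇒≥ a≮b)) a≢b

  lowPeaks<lowPits : ∀ σ → Unique σ → Any (_≤ t) σ → Any (t <_) σ →
    count (low? ∩? peak?) (windows (closeUp σ)) < count (low? ∩? pit?) (windows (closeUp σ))
  lowPeaks<lowPits (y ∷ [])    _  (here y≤t) (here t<y) = contradiction y≤t (<⇒≱ t<y)
  lowPeaks<lowPits (y ∷ w ∷ r) !σ low high = +-cancelˡ-≤ into (suc peaks) pits (begin
    into + suc peaks ≡⟨ +-suc into peaks ⟩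
    suc into + peaks ≤⟨ +-monoˡ-≤ peaks crossing ⟩
    from + peaks     ≤⟨ balance ⟩
    intoˡ + pits     ≡⟨ cong (_+ pits) rotation ⟩
    into + pits      ∎)
    where
    open ≤-Reasoning
    σ = y ∷ w ∷ r
    ws = windows (closeUp σ)
    peaks = count (low? ∩? peak?) ws
    pits  = count (low? ∩? pit?) ws
    into  = count (ascentInto? ∘ rightEdge) ws
    intoˡ = count (ascentInto? ∘ leftEdge) ws
    from  = count (ascentFrom? ∘ rightEdge) ws

    crossing : into < from
    crossing = count-mono-< (ascentInto? ∘ rightEdge) (ascentFrom? ∘ rightEdge) ascentInto⇒ascentFrom
      (Any.map (λ {w} → crossing⇒ascentFrom w) (Any.map⁻ (cyclic-crossing σ low high)))

    balance : from + peaks ≤ intoˡ + pits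
    balance = count-+-mono (ascentFrom? ∘ rightEdge) (low? ∩? peak?) (ascentInto? ∘ leftEdge) (low? ∩? pit?)
      (All.map (λ {w} → window-balance w)
        (All.map⁻ (All-resp-↭ (↭-sym (leftEdges↭rightEdges σ)) (cyclicEdges-distinct y w r !σ))))

    rotation : intoˡ ≡ into
    rotation = begin-equality
      intoˡ                                ≡⟨ count-map ascentInto? leftEdge ws ⟨
      count ascentInto? (map leftEdge ws)  ≡⟨ count-↭ ascentInto? (leftEdges↭rightEdges σ) ⟩
      count ascentInto? (map rightEdge ws) ≡⟨ count-map ascentInto? rightEdge ws ⟩
      into                                 ∎

  count-low-extrema : ∀ {P : Pred Window 0ℓ} (P? : Decidable P) u →
    count (_≤? t) (extrema P? u) ≡ count (low? ∩? P?) (windows u)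
  count-low-extrema P? u =
    trans (count-map (_≤? t) middle (filter P? (windows u))) (count-filter low? P? (windows u))

  lowPinnacles<lowVales : ∀ σ → Unique σ → Any (_≤ t) σ → Any (t <_) σ →
    count (_≤? t) (pinnacles σ) < count (_≤? t) (vales σ)
  lowPinnacles<lowVales σ !σ low high
    rewrite count-low-extrema peak? (closeUp σ) | count-low-extrema pit? (closeUp σ) =
    lowPeaks<lowPits σ !σ low high

-- Admissible pairs are interlaced

Interlaced : List ℕ → List ℕ → Set
Interlaced Q W = Pointwise _<_ W Q

nAdmissible-ballot : ∀ {n Q W} → Unique Q → NAdmissible n Q W → ∀ {t} → 1 ≤ t → t < n →
  count (_≤? t) Q ≤ count (_≤? t) W
nAdmissible-ballot {n} {Q} {W} !Q (_ , σ , σ↭ , pin , val) {t} 1≤t t<n = ≤-pred (begin-strict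
  count (_≤? t) Q
    ≤⟨ length-mono-⊆ (Unique.filter⁺ (_≤? t) !Q) lowQ⊆ ⟩
  count (_≤? t) (pinnacles σ)
    <⟨ lowPinnacles<lowVales t σ !σ (find 1≤t 1∈σ) (find t<n n∈σ) ⟩
  count (_≤? t) (vales σ)
    ≤⟨ length-mono-⊆ (Unique.filter⁺ (_≤? t) (extrema-unique pit? σ !σ)) lowVales⊆ ⟩
  suc (count (_≤? t) W)
    ∎)
  where
  open ≤-Reasoning
  !σ : Unique σ
  !σ = unique-resp-↭ σ↭ (oneTo-unique n)
  1∈σ : 1 ∈ σ
  1∈σ = ∈-resp-↭ (↭-sym σ↭) (∈-oneTo⁺ ≤-refl (≤-trans 1≤t (<⇒≤ t<n)))
  n∈σ : n ∈ σ
  n∈σ = ∈-resp-↭ (↭-sym σ↭) (∈-oneTo⁺ (≤-trans 1≤t (<⇒≤ t<n)) ≤-refl)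
  find : ∀ {P : ℕ → Set} {x} → P x → x ∈ σ → Any P σ
  find Px = Any.map (λ { refl → Px })
  lowQ⊆ : filter (_≤? t) Q ⊆ filter (_≤? t) (pinnacles σ)
  lowQ⊆ {x} x∈ with x∈Q , x≤t ← ∈-filter⁻ (_≤? t) x∈ =
    ∈-filter⁺ (_≤? t) (Equivalence.to (isPinnacle⇔∈pinnacles σ x) (Equivalence.from (pin x) (inj₁ x∈Q))) x≤t
  lowVales⊆ : filter (_≤? t) (vales σ) ⊆ 1 ∷ filter (_≤? t) W
  lowVales⊆ {x} x∈ with x∈vales , x≤t ← ∈-filter⁻ (_≤? t) x∈
    with Equivalence.to (val x) (Equivalence.from (isVale⇔∈vales σ x) x∈vales)
  ... | inj₁ x∈W  = there (∈-filter⁺ (_≤? t) x∈W x≤t)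
  ... | inj₂ refl = here refl

ballot⇒interlaced : ∀ {Q W} → AllPairs _<_ Q → AllPairs _<_ W → (∀ x → x ∈ Q → x ∉ W) →
  length Q ≡ length W → (∀ t → t ∈ Q → count (_≤? t) Q ≤ count (_≤? t) W) → Interlaced Q W
ballot⇒interlaced {[]}    {[]}    _         _         _        _   _      = []
ballot⇒interlaced {q ∷ Q} {w ∷ W} (q< ∷ sQ) (w< ∷ sW) disjoint len ballot =
  ≤∧≢⇒< w≤q (λ { refl → disjoint q (here refl) (here refl) })
  ∷ ballot⇒interlaced sQ sW (λ x x∈Q x∈W → disjoint x (there x∈Q) (there x∈W)) (suc-injective len) ballot′
  where
  w≤q : w ≤ q
  w≤q = ≮⇒≥ λ q<w → contradiction
    (subst₂ _≤_ (count-accept (_≤? q) Q ≤-refl) (cong length (filter-none (_≤? q) (above q<w)))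
      (ballot q (here refl)))
    λ ()
    where
    above : q < w → All (λ x → ¬ x ≤ q) (w ∷ W)
    above q<w = <⇒≱ q<w ∷ All.map (λ w<x → <⇒≱ (<-trans q<w w<x)) w<
  ballot′ : ∀ t → t ∈ Q → count (_≤? t) Q ≤ count (_≤? t) W
  ballot′ t t∈Q = ≤-pred (subst₂ _≤_
    (count-accept (_≤? t) Q (<⇒≤ q<t)) (count-accept (_≤? t) W (<⇒≤ (≤-<-trans w≤q q<t)))
    (ballot t (there t∈Q)))
    where q<t = All.lookup q< t∈Q

admissible⇒interlaced : ∀ {Q W} → AllPairs _<_ Q → AllPairs _<_ W → All (2 ≤_) Q →
  (∀ x → x ∈ Q → x ∉ W) → length Q ≡ length W → Admissible Q W → Interlaced Q W
admissible⇒interlaced sQ sW 2≤Q disjoint len (n , adm@(Q<n , _)) = ballot⇒interlaced sQ sW disjoint len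
  λ t t∈Q → nAdmissible-ballot (sorted⇒unique sQ) adm (<⇒≤ (All.lookup 2≤Q t∈Q)) (Q<n t t∈Q)

-- Interlaced pairs are admissible

zigzag : List ℕ → List ℕ → List ℕ
zigzag (q ∷ Q) (w ∷ W) = q ∷ w ∷ zigzag Q W
zigzag _       _       = []

zigzag-↭ : ∀ {R : ℕ → ℕ → Set} {Q W} → Pointwise R W Q → zigzag Q W ↭ Q ++ W
zigzag-↭ []                               = ↭-refl
zigzag-↭ {Q = q ∷ Q} {W = w ∷ W} (_ ∷ rs) = prep q (↭-trans (prep w (zigzag-↭ rs)) (↭-sym (shift w Q W)))

zigzag-pinnacles : ∀ {ℓ a N Q W} → a < ℓ → Interlaced Q W → AllPairs _<_ Q → All (a <_) Q →
  extrema peak? (ℓ ∷ a ∷ zigzag Q W ++ [ N ]) ≡ Q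
zigzag-pinnacles a<ℓ [] _ _ = extrema-reject peak? [] (λ (ℓ<a , _) → <-asym a<ℓ ℓ<a)
zigzag-pinnacles {ℓ} {a} {N} {q ∷ Q} {w ∷ W} a<ℓ (w<q ∷ ws) (q< ∷ sQ) (a<q ∷ _) = begin
  extrema peak? (ℓ ∷ a ∷ q ∷ w ∷ zigzag Q W ++ [ N ])
    ≡⟨ extrema-reject peak? _ (λ (ℓ<a , _) → <-asym a<ℓ ℓ<a) ⟩
  extrema peak? (a ∷ q ∷ w ∷ zigzag Q W ++ [ N ])
    ≡⟨ extrema-accept peak? _ (a<q , w<q) ⟩
  q ∷ extrema peak? (q ∷ w ∷ zigzag Q W ++ [ N ])
    ≡⟨ cong (q ∷_) (zigzag-pinnacles w<q ws sQ (All.map (<-trans w<q) q<)) ⟩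
  q ∷ Q
    ∎
  where open ≡-Reasoning

zigzag-vales : ∀ {ℓ a N Q W} → a < ℓ → a < N → Interlaced Q W → AllPairs _<_ Q →
  All (a <_) Q → All (_< N) Q → extrema pit? (ℓ ∷ a ∷ zigzag Q W ++ [ N ]) ≡ a ∷ W
zigzag-vales a<ℓ a<N [] _ _ _ = extrema-accept pit? [] (a<ℓ , a<N)
zigzag-vales {ℓ} {a} {N} {q ∷ Q} {w ∷ W} a<ℓ a<N (w<q ∷ ws) (q< ∷ sQ) (a<q ∷ _) (q<N ∷ Q<N) = begin
  extrema pit? (ℓ ∷ a ∷ q ∷ w ∷ zigzag Q W ++ [ N ])
    ≡⟨ extrema-accept pit? _ (a<ℓ , a<q) ⟩
  a ∷ extrema pit? (a ∷ q ∷ w ∷ zigzag Q W ++ [ N ])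
    ≡⟨ cong (a ∷_) (extrema-reject pit? _ (λ (q<a , _) → <-asym a<q q<a)) ⟩
  a ∷ extrema pit? (q ∷ w ∷ zigzag Q W ++ [ N ])
    ≡⟨ cong (a ∷_) (zigzag-vales w<q (<-trans w<q q<N) ws sQ (All.map (<-trans w<q) q<) Q<N) ⟩
  a ∷ w ∷ W
    ∎
  where open ≡-Reasoning

module Construction {Q W : List ℕ}
  (sortedQ : AllPairs _<_ Q) (sortedW : AllPairs _<_ W) (2≤Q : All (2 ≤_) Q) (2≤W : All (2 ≤_) W)
  (disjoint : ∀ x → x ∈ Q → x ∉ W) (interlaced : Interlaced Q W) where

  N : ℕ
  N = suc (max 1 (Q ++ W))

  Unused : Pred ℕ 0ℓ
  Unused x = 2 ≤ x × x ∉ Q ++ W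

  unused? : Decidable Unused
  unused? x = 2 ≤? x ×-dec ¬? (x ∈? Q ++ W)

  fillers : List ℕ
  fillers = filter unused? (downFrom N)

  σ : List ℕ
  σ = N ∷ fillers ++ 1 ∷ zigzag Q W

  1<N : 1 < N
  1<N = s≤s (v≤max⁺ 1 (Q ++ W) (inj₁ ≤-refl))

  QW<N : All (_< N) (Q ++ W)
  QW<N = All.map s≤s (xs≤max 1 (Q ++ W))

  Q<N : All (_< N) Q
  Q<N = All.++⁻ˡ Q QW<N

  filler-bounds : ∀ {x} → x ∈ fillers → Unused x × x < N
  filler-bounds x∈ with x∈↓ , unused ← ∈-filter⁻ unused? x∈ = unused , ∈-downFrom⁻ x∈↓

  1<fillers : All (1 <_) fillers
  1<fillers = All.tabulate (proj₁ ∘ proj₁ ∘ filler-bounds)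

  fillers<N : All (_< N) fillers
  fillers<N = All.tabulate (proj₂ ∘ filler-bounds)

  fillers-descending : AllPairs _>_ fillers
  fillers-descending = AllPairs.filter⁺ unused? (AllPairs.applyDownFrom⁺₁ (λ x → x) N (λ j<i _ → j<i))

  closeUp-σ : closeUp σ ≡ lastOf 1 (zigzag Q W) ∷ N ∷ fillers ++ 1 ∷ zigzag Q W ++ [ N ]
  closeUp-σ = cong₂ _∷_ (lastOf-++ N fillers 1 (zigzag Q W))
    (cong (N ∷_) (++-assoc fillers (1 ∷ zigzag Q W) [ N ]))

  ℓ<N : lastOf 1 (zigzag Q W) < N
  ℓ<N = All.lookup (1<N ∷ All-resp-↭ (↭-sym (zigzag-↭ interlaced)) QW<N) (lastOf-∈ 1 (zigzag Q W))

  1<ℓ′ : 1 < lastOf N fillers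
  1<ℓ′ = All.lookup (1<N ∷ 1<fillers) (lastOf-∈ N fillers)

  pinnacles-σ : pinnacles σ ≡ N ∷ Q
  pinnacles-σ = begin
    pinnacles σ
      ≡⟨ cong (extrema peak?) closeUp-σ ⟩
    extrema peak? (_ ∷ N ∷ fillers ++ 1 ∷ zigzag Q W ++ [ N ])
      ≡⟨ peak-descent fillers _ ℓ<N 1<N (fillers<N ∷ fillers-descending) 1<fillers ⟩
    N ∷ extrema peak? (lastOf N fillers ∷ 1 ∷ zigzag Q W ++ [ N ])
      ≡⟨ cong (N ∷_) (zigzag-pinnacles 1<ℓ′ interlaced sortedQ 2≤Q) ⟩
    N ∷ Q
      ∎
    where open ≡-Reasoning

  vales-σ : vales σ ≡ 1 ∷ W
  vales-σ = begin
    vales σ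
      ≡⟨ cong (extrema pit?) closeUp-σ ⟩
    extrema pit? (_ ∷ N ∷ fillers ++ 1 ∷ zigzag Q W ++ [ N ])
      ≡⟨ pit-descent fillers _ ℓ<N (fillers<N ∷ fillers-descending) 1<fillers ⟩
    extrema pit? (lastOf N fillers ∷ 1 ∷ zigzag Q W ++ [ N ])
      ≡⟨ zigzag-vales 1<ℓ′ 1<N interlaced sortedQ 2≤Q Q<N ⟩
    1 ∷ W
      ∎
    where open ≡-Reasoning

  rest : List ℕ
  rest = fillers ++ 1 ∷ Q ++ W

  rest-unique : Unique rest
  rest-unique = Unique.++⁺ fillers-unique
    (All.map <⇒≢ (All.++⁺ 2≤Q 2≤W) ∷ Unique.++⁺ (sorted⇒unique sortedQ) (sorted⇒unique sortedW) Q∩W≡∅)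
    fillers∩rest≡∅
    where
    fillers-unique : Unique fillers
    fillers-unique = AllPairs.map (λ y<x → ≢-sym (<⇒≢ y<x)) fillers-descending
    Q∩W≡∅ : ∀ {x} → ¬ (x ∈ Q × x ∈ W)
    Q∩W≡∅ (x∈Q , x∈W) = disjoint _ x∈Q x∈W
    fillers∩rest≡∅ : ∀ {x} → ¬ (x ∈ fillers × x ∈ 1 ∷ Q ++ W)
    fillers∩rest≡∅ (x∈ , here refl)   with s≤s () ← proj₁ (proj₁ (filler-bounds x∈))
    fillers∩rest≡∅ (x∈ , there x∈QW) = proj₂ (proj₁ (filler-bounds x∈)) x∈QW

  N∷rest↭oneTo : N ∷ rest ↭ oneTo N
  N∷rest↭oneTo = ∼bag⇒↭ (unique∧set⇒bag (All.map (≢-sym ∘ <⇒≢) rest<N ∷ rest-unique) (oneTo-unique N)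
    (mk⇔ to from))
    where
    rest<N : All (_< N) rest
    rest<N = All.++⁺ fillers<N (1<N ∷ QW<N)
    1≤rest : All (1 ≤_) rest
    1≤rest = All.++⁺ (All.map <⇒≤ 1<fillers) (≤-refl ∷ All.map <⇒≤ (All.++⁺ 2≤Q 2≤W))
    to : ∀ {x} → x ∈ N ∷ rest → x ∈ oneTo N
    to (here refl) = ∈-oneTo⁺ (s≤s z≤n) ≤-refl
    to (there x∈)  = ∈-oneTo⁺ (All.lookup 1≤rest x∈) (<⇒≤ (All.lookup rest<N x∈))
    from : ∀ {x} → x ∈ oneTo N → x ∈ N ∷ rest
    from {x} x∈ with 1≤x , x≤N ← ∈-oneTo⁻ x∈ with m≤n⇒m<n∨m≡n x≤N | m≤n⇒m<n∨m≡n 1≤x | x ∈? Q ++ W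
    ... | inj₂ refl | _         | _        = here refl
    ... | inj₁ _    | inj₂ refl | _        = there (∈-++⁺ʳ fillers (here refl))
    ... | inj₁ _    | inj₁ _    | yes x∈QW = there (∈-++⁺ʳ fillers (there x∈QW))
    ... | inj₁ x<N  | inj₁ 1<x  | no x∉QW  =
      there (∈-++⁺ˡ (∈-filter⁺ unused? (∈-downFrom⁺ x<N) (1<x , x∉QW)))

  σ↭oneTo : σ ↭ oneTo N
  σ↭oneTo = ↭-trans (prep N (++⁺ˡ fillers (prep 1 (zigzag-↭ interlaced)))) N∷rest↭oneTo

interlaced⇒admissible : ∀ {Q W} → AllPairs _<_ Q → AllPairs _<_ W → All (2 ≤_) Q → All (2 ≤_) W →
  (∀ x → x ∈ Q → x ∉ W) → Interlaced Q W → Admissible Q W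
interlaced⇒admissible sQ sW 2≤Q 2≤W disjoint interlaced =
  N , (λ q → All.lookup Q<N) , σ , σ↭oneTo ,
  (λ x → ∈-∷⇔ ⇔-∘ subst (λ ps → IsPinnacle σ x ⇔ x ∈ ps) pinnacles-σ (isPinnacle⇔∈pinnacles σ x)) ,
  (λ x → ∈-∷⇔ ⇔-∘ subst (λ vs → IsVale σ x ⇔ x ∈ vs) vales-σ (isVale⇔∈vales σ x))
  where open Construction sQ sW 2≤Q 2≤W disjoint interlaced

-- The statement holds for prefixes of every length.
corollary3p7 : (k : ℕ) (Q W : List ℕ) →
    AllPairs _<_ Q → AllPairs _<_ W →
    All (2 ≤_) Q → All (2 ≤_) W →
    (∀ x → x ∈ Q → x ∉ W) →
    length Q ≡ k → length W ≡ k → 1 ≤ k →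
    Admissible Q W →
    (i : ℕ) → i < k →
    Admissible (take (k ∸ suc i) Q) (take (k ∸ suc i) W)
corollary3p7 k Q W sQ sW 2≤Q 2≤W disjoint |Q|≡k |W|≡k _ admissible i _ =
  interlaced⇒admissible (AllPairs.take⁺ r sQ) (AllPairs.take⁺ r sW) (All.take⁺ r 2≤Q) (All.take⁺ r 2≤W)
    (λ x x∈Q x∈W → disjoint x (∈-take r x∈Q) (∈-take r x∈W))
    (Pointwise-take r (admissible⇒interlaced sQ sW 2≤Q disjoint (trans |Q|≡k (sym |W|≡k)) admissible))
  where
  r = k ∸ suc i
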